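{- Let $G$ be a split graph whose vertex set is partitioned as $I^*\cup K$, where $K$ is a clique and $I^*$ is an independent set with $|I^*|=\alpha(G)$, and let $H$ be a finite simple graph. Then $\gamma_{gr}(G\circ H)=|I^*|\gamma_{gr}(H)+n(G)$.
   Context: $n(G)=1$ if there exist $v,w\in K$ with $N(v)\cap N(w)\cap I^*=\emptyset$, and $n(G)=0$ otherwise. The lexicographic product $G\circ H$ has vertex set $V(G)\times V(H)$ with $(g_1,h_1)\sim(g_2,h_2)$ iff $g_1g_2\in E(G)$, or $g_1=g_2$ and $h_1h_2\in E(H)$. For a sequence $S=(v_1,\dots,v_k)$ of distinct vertices, $PN_S(v_i)=N[v_i]\setminus\bigcup_{j<i}N[v_j]$; $S$ is legal dominating if $\{v_1,\dots,v_k\}$ dominates the graph and each $PN_S(v_i)\ne\emptyset$; $\gamma_{gr}$ is the maximum length of such a sequence. -}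

module Defs where

open import Data.Nat using (ℕ; _≤_; _*_; _+_)
open import Data.Fin using (Fin; _≟_; remQuot)
open import Data.Fin.Subset using (Subset; _∈_; _∉_; ∣_∣)
open import Data.Bool using (Bool; true; false; _∧_; _∨_; not; if_then_else_)
open import Data.List using (List; []; _∷_; _++_; length; allFin)
open import Data.Bool.ListAction using (all; any)
open import Data.List.Relation.Unary.All using (All)
open import Data.List.Relation.Unary.Any using (Any)
open import Data.List.Relation.Unary.Unique.Propositional using (Unique)
open import Data.Vec using (lookup)
open import Data.Product using (Σ; ∃; _×_; _,_)
open import Data.Sum using (_⊎_)
open import Data.Unit using (⊤)
open import Relation.Nullary using (¬_; does)
open import Relation.Binary.PropositionalEquality using (_≡_; _≢_)

Adj : ℕ → Set
Adj n = Fin n → Fin n → Bool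

IsSimple : ∀ {n} → Adj n → Set
IsSimple {n} A = (∀ u v → A u v ≡ A v u) × (∀ v → A v v ≡ false)

CN : ∀ {n} → Adj n → Fin n → Fin n → Set
CN A v x = (v ≡ x) ⊎ (A v x ≡ true)

LegalFrom : ∀ {n} → Adj n → List (Fin n) → List (Fin n) → Set
LegalFrom A prev [] = ⊤
LegalFrom A prev (v ∷ vs) =
  (∃ λ x → CN A v x × All (λ u → ¬ CN A u x) prev) × LegalFrom A (prev ++ (v ∷ [])) vs

Dominates : ∀ {n} → Adj n → List (Fin n) → Set
Dominates {n} A S = ∀ (x : Fin n) → Any (λ v → CN A v x) S

LegalDom : ∀ {n} → Adj n → List (Fin n) → Set
LegalDom A S = Unique S × Dominates A S × LegalFrom A [] S

IsGrundyDomNumber : ∀ {n} → Adj n → ℕ → Set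
IsGrundyDomNumber A k =
  (∃ λ S → LegalDom A S × length S ≡ k) × (∀ S → LegalDom A S → length S ≤ k)

lex : ∀ {m n} → Adj m → Adj n → Adj (m * n)
lex {m} {n} G H i j with remQuot {m} n i | remQuot {m} n j
... | g₁ , h₁ | g₂ , h₂ = G g₁ g₂ ∨ (does (g₁ ≟ g₂) ∧ H h₁ h₂)

Independent : ∀ {n} → Adj n → Subset n → Set
Independent {n} A S = ∀ (u v : Fin n) → u ∈ S → v ∈ S → A u v ≡ false

IsMaxIndependent : ∀ {n} → Adj n → Subset n → Set
IsMaxIndependent {n} A S = Independent A S × (∀ (T : Subset n) → Independent A T → ∣ T ∣ ≤ ∣ S ∣)

ComplementClique : ∀ {n} → Adj n → Subset n → Set
ComplementClique {n} A I = ∀ (u v : Fin n) → u ∉ I → v ∉ I → u ≢ v → A u v ≡ true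

-- n(G) = 1 iff ∃ v, w ∈ K with N(v) ∩ N(w) ∩ I* = ∅
nG : ∀ {n} → Adj n → Subset n → ℕ
nG {n} G I =
  if any (λ v → any (λ w → not (lookup I v) ∧ not (lookup I w)
            ∧ all (λ x → not (lookup I x ∧ G v x ∧ G w x)) (allFin n)) (allFin n)) (allFin n)
  then 1 else 0

{-# OPTIONS --safe #-}
-- Every element s of a legal sequence of G ∘ H is charged to the fibre {X} × V(H) holding a
-- chosen private neighbour of s. The elements charged to one fibre, read in H, form a legal
-- sequence of H, so each fibre is charged at most γ_gr(H) times. Before the first element s in
-- a K-fibre c every element lies in an I*-fibre and is charged to its own fibre; after s every
-- fibre adjacent to c is dominated and is charged nothing more. Hence only c and the fibre of the
-- private neighbour of s can be charged among the K-fibres, and a short case analysis leaves room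
-- for one extra charge at most, and for none when any two K-vertices have a common I*-neighbour.
-- Conversely, a γ_gr(H)-sequence of H played in every I*-fibre is legal; when n(G) = 1, witnessed
-- by v and w, inserting (v, t) between the I*-fibres not adjacent to w and those adjacent to w
-- gains one more element, with private neighbour (w, t).
module Submission where

open import Defs
open import Data.Nat using (ℕ; zero; suc; _≤_; _<_; _*_; _+_; z≤n; s≤s)
open import Data.Nat.Properties
  using (+-mono-≤; +-identityʳ; +-suc; +-comm; +-assoc; ≤-reflexive; ≤-trans; m≤n+m; m≤m+n; <⇒≱; +-*-semiring)
open import Data.Fin using (Fin; zero; suc; _≟_; remQuot; combine; fromℕ<)
open import Data.Fin.Properties using (any?; remQuot-combine; combine-remQuot)
open import Data.Fin.Permutation using (transpose; _⟨$⟩ʳ_)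
open import Data.Fin.Subset using (Subset; ∣_∣; inside; outside; _∈_; _∉_; _∪_; ⁅_⁆)
open import Data.Fin.Subset.Properties
  using (_∈?_; p⊆p∪q; x∈p∪q⁺; x∈p∪q⁻; x∈⁅x⁆; x∈⁅y⁆⇒x≡y; p⊂q⇒∣p∣<∣q∣)
open import Data.Bool using (Bool; true; false; T; _∧_; _∨_; not; if_then_else_)
import Data.Bool as Bool
open import Data.Bool.Properties using (¬-not; ∨-zeroʳ)
open import Data.Bool.ListAction using (all; any)
open import Data.Vec using ([]; _∷_; lookup)
open import Data.Vec.Properties using ([]=⇒lookup; lookup⇒[]=)
open import Data.List using (List; []; _∷_; _++_; [_]; _∷ʳ_; length; allFin; map; concatMap; tabulate)
open import Data.List.Properties using (++-assoc; ++-identityʳ; length-++; length-map)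
open import Data.List.Relation.Unary.All using (All; []; _∷_; all?)
import Data.List.Relation.Unary.All as All
open import Data.List.Relation.Unary.All.Properties
  using (¬Any⇒All¬; All¬⇒¬Any; ++⁺; ++⁻ˡ; ∷ʳ⁺; ∷ʳ⁻; all⁺; all⁻; tabulate⁺; concat⁺)
import Data.List.Relation.Unary.All.Properties as Allₚ
open import Data.List.Relation.Unary.Any using (Any; here; there; satisfied)
import Data.List.Relation.Unary.Any as Any
open import Data.List.Relation.Unary.Any.Properties using (++⁺ˡ; ++⁺ʳ; any⁺; any⁻)
import Data.List.Relation.Unary.Any.Properties as Anyₚ
open import Data.List.Relation.Unary.AllPairs using ([]; _∷_)
open import Data.List.Relation.Unary.Unique.Propositional using (Unique)
open import Data.List.Relation.Unary.Unique.Propositional.Properties using (allFin⁺)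
open import Data.List.Relation.Unary.First using (first) renaming (_++_∷_ to prefix-first-rest)
open import Data.List.Relation.Unary.First.Properties using (toView)
open import Data.List.Membership.Propositional using (find; lose) renaming (_∈_ to _∈ₗ_; _∉_ to _∉ₗ_)
open import Data.List.Membership.Propositional.Properties using (∈-allFin)
open import Data.Product using (∃; ∃₂; _×_; _,_; proj₁; proj₂)
open import Data.Sum using (_⊎_; inj₁; inj₂)
open import Data.Unit using (tt)
open import Data.Empty using (⊥; ⊥-elim)
open import Function using (_∘_)
open import Relation.Unary using (Decidable)
open import Relation.Nullary using (¬_; Dec; yes; no; does; ¬?; _×-dec_; _⊎-dec_; contradiction)
open import Relation.Nullary.Decidable using (dec-true; dec-false)
open import Relation.Binary.PropositionalEquality
  using (_≡_; _≢_; refl; sym; trans; cong; cong₂; subst; subst₂; module ≡-Reasoning)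
open import Algebra.Properties.Semiring.Sum +-*-semiring
  using (sum; sum-syntax; sum-replicate-zero; sum-cong-≗; ∑-distrib-+; ∑-permute)

∑-mono-≤ : ∀ {m} {f g : Fin m → ℕ} → (∀ X → f X ≤ g X) → sum f ≤ sum g
∑-mono-≤ {zero}  f≤g = z≤n
∑-mono-≤ {suc m} f≤g = +-mono-≤ (f≤g zero) (∑-mono-≤ (f≤g ∘ suc))

∑-δ : ∀ {m} (c : Fin m) a → ∑[ X < m ] (if does (c ≟ X) then a else 0) ≡ a
∑-δ {suc m} zero    a = trans (cong (a +_) (sum-replicate-zero m)) (+-identityʳ a)
∑-δ {suc m} (suc c) a = ∑-δ c a

∑-indicator : ∀ {m} (I : Subset m) k → ∑[ X < m ] (if does (X ∈? I) then k else 0) ≡ ∣ I ∣ * k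
∑-indicator []            k = refl
∑-indicator (inside ∷ I)  k = cong (k +_) (∑-indicator I k)
∑-indicator (outside ∷ I) k = ∑-indicator I k

module Budget {m : ℕ} (I : Subset m) (k : ℕ) (b : Fin m → ℕ) (b≤k : ∀ X → b X ≤ k) where

  budget : Fin m → ℕ
  budget X = if does (X ∈? I) then k else 0

  ∑-budget : ∑[ X < m ] budget X ≡ ∣ I ∣ * k
  ∑-budget = ∑-indicator I k

  b≤budget : ∀ X → (X ∉ I → b X ≡ 0) → b X ≤ budget X
  b≤budget X b₀ with X ∈? I
  ... | yes _   = b≤k X
  ... | no  X∉I = ≤-reflexive (b₀ X∉I)

  ∑≤budget : (∀ X → X ∉ I → b X ≡ 0) → sum b ≤ ∣ I ∣ * k
  ∑≤budget b₀ = subst (sum b ≤_) ∑-budget (∑-mono-≤ (λ X → b≤budget X (b₀ X)))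

  ∑≤budget+1 : ∀ c → b c ≤ 1 → (∀ X → X ∉ I → X ≢ c → b X ≡ 0) → sum b ≤ ∣ I ∣ * k + 1
  ∑≤budget+1 c bc≤1 b₀ = subst (sum b ≤_) ∑-budget+δ (∑-mono-≤ pointwise)
    where
      δ : Fin m → ℕ
      δ X = if does (c ≟ X) then 1 else 0

      ∑-budget+δ : ∑[ X < m ] (budget X + δ X) ≡ ∣ I ∣ * k + 1
      ∑-budget+δ = trans (∑-distrib-+ budget δ) (cong₂ _+_ ∑-budget (∑-δ c 1))

      pointwise : ∀ X → b X ≤ budget X + δ X
      pointwise X with c ≟ X
      ... | yes refl = ≤-trans bc≤1 (m≤n+m 1 (budget c))
      ... | no c≢X   = ≤-trans (b≤budget X (λ X∉I → b₀ X X∉I (c≢X ∘ sym))) (m≤m+n (budget X) 0)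

  -- The empty I-fibre g lends its budget to c: compare b with budget ∘ transposition (c g).
  ∑≤budget-swap : ∀ c g → g ∈ I → b g ≡ 0 → (∀ X → X ∉ I → X ≢ c → b X ≡ 0) → sum b ≤ ∣ I ∣ * k
  ∑≤budget-swap c g g∈I bg≡0 b₀ =
    subst (sum b ≤_) (trans (sym (∑-permute budget (transpose c g))) ∑-budget) (∑-mono-≤ pointwise)
    where
      pointwise : ∀ X → b X ≤ budget (transpose c g ⟨$⟩ʳ X)
      pointwise X with X ≟ c
      ... | yes refl rewrite dec-true (g ∈? I) g∈I = b≤k X
      ... | no X≢c with X ≟ g
      ...   | yes refl rewrite bg≡0 = z≤n
      ...   | no _ = b≤budget X (λ X∉I → b₀ X X∉I X≢c)

length-concatMap-tabulate : ∀ {A B : Set} {m} (f : A → List B) (h : Fin m → A)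
                          → length (concatMap f (tabulate h)) ≡ ∑[ i < m ] length (f (h i))
length-concatMap-tabulate {m = zero}  f h = refl
length-concatMap-tabulate {m = suc m} f h =
  trans (length-++ (f (h zero))) (cong (length (f (h zero)) +_) (length-concatMap-tabulate f (h ∘ suc)))

length-∷ʳ : ∀ {A : Set} (xs : List A) x → length (xs ∷ʳ x) ≡ suc (length xs)
length-∷ʳ xs x = trans (length-++ xs) (+-comm (length xs) 1)

any-allFin⁺ : ∀ {m} (p : Fin m → Bool) x → T (p x) → T (any p (allFin m))
any-allFin⁺ p x px = any⁺ p (Any.map (λ { refl → px }) (∈-allFin x))

module Sequences {N : ℕ} (A : Adj N) where

  Dominated : List (Fin N) → Fin N → Set
  Dominated P x = Any (λ u → CN A u x) P

  Undominated : List (Fin N) → Fin N → Set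
  Undominated P x = All (λ u → ¬ CN A u x) P

  Private : List (Fin N) → Fin N → Fin N → Set
  Private P v x = CN A v x × Undominated P x

  CN? : ∀ u x → Dec (CN A u x)
  CN? u x = (u ≟ x) ⊎-dec (A u x Bool.≟ Bool.true)

  dominated? : ∀ P x → Dec (Dominated P x)
  dominated? P x = Any.any? (λ u → CN? u x) P

  undominated? : ∀ P x → Dec (Undominated P x)
  undominated? P x = all? (λ u → ¬? (CN? u x)) P

  ¬dominated⇒undominated : ∀ {P x} → ¬ Dominated P x → Undominated P x
  ¬dominated⇒undominated = ¬Any⇒All¬ _

  undominated⇒¬dominated : ∀ {P x} → Undominated P x → ¬ Dominated P x
  undominated⇒¬dominated = All¬⇒¬Any

  legal-++⁺ : ∀ P X {Y} → LegalFrom A P X → LegalFrom A (P ++ X) Y → LegalFrom A P (X ++ Y)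
  legal-++⁺ P []      _         lY = subst (λ Q → LegalFrom A Q _) (++-identityʳ P) lY
  legal-++⁺ P (v ∷ X) (pv , lX) lY =
    pv , legal-++⁺ (P ∷ʳ v) X lX (subst (λ Q → LegalFrom A Q _) (sym (++-assoc P [ v ] X)) lY)

  legal-++⁻ : ∀ P X {Y} → LegalFrom A P (X ++ Y) → LegalFrom A P X × LegalFrom A (P ++ X) Y
  legal-++⁻ P []      l         = tt , subst (λ Q → LegalFrom A Q _) (sym (++-identityʳ P)) l
  legal-++⁻ P (v ∷ X) (pv , l) with legal-++⁻ (P ∷ʳ v) X l
  ... | lX , lY = (pv , lX) , subst (λ Q → LegalFrom A Q _) (++-assoc P [ v ] X) lY

  legal-∷ʳ : ∀ P S {v x} → LegalFrom A P S → Private (P ++ S) v x → LegalFrom A P (S ∷ʳ v)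
  legal-∷ʳ P S l p = legal-++⁺ P S l ((_ , p) , tt)

  private-∉ : ∀ {P v x} → Private P v x → v ∉ₗ P
  private-∉ (c , u) v∈P = All.lookup u v∈P c

  legal⇒∉ : ∀ P S → LegalFrom A P S → All (_∉ₗ P) S
  legal⇒∉ P []      _             = []
  legal⇒∉ P (v ∷ S) ((_ , p) , l) = private-∉ p ∷ All.map (λ s∉ → s∉ ∘ ++⁺ˡ) (legal⇒∉ (P ∷ʳ v) S l)

  legal⇒unique : ∀ P S → LegalFrom A P S → Unique S
  legal⇒unique P []      _       = []
  legal⇒unique P (v ∷ S) (_ , l) =
    All.map (λ s∉ v≡s → s∉ (++⁺ʳ P (here (sym v≡s)))) (legal⇒∉ (P ∷ʳ v) S l)
    ∷ legal⇒unique (P ∷ʳ v) S l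

  legal-extend : ∀ P xs → ∃ λ Q → LegalFrom A P Q × All (Dominated (P ++ Q)) xs
  legal-extend P []       = [] , tt , []
  legal-extend P (x ∷ xs) with dominated? P x
  ... | yes d with legal-extend P xs
  ...   | Q , lQ , dQ = Q , lQ , ++⁺ˡ d ∷ dQ
  legal-extend P (x ∷ xs) | no ¬d with legal-extend (P ∷ʳ x) xs
  ...   | Q , lQ , dQ =
    x ∷ Q , ((x , inj₁ refl , ¬dominated⇒undominated ¬d) , lQ) ,
    ++⁺ʳ P (here (inj₁ refl)) ∷ subst (λ R → All (Dominated R) xs) (++-assoc P [ x ] Q) dQ

  legal⇒length≤ : ∀ {k} → IsGrundyDomNumber A k → ∀ T → LegalFrom A [] T → length T ≤ k
  legal⇒length≤ (_ , maximal) T l with legal-extend T (allFin N)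
  ... | Q , lQ , dQ =
    ≤-trans (subst (length T ≤_) (sym (length-++ T)) (m≤m+n _ _))
            (maximal (T ++ Q) (legal⇒unique [] (T ++ Q) lTQ , (λ x → All.lookup dQ (∈-allFin x)) , lTQ))
    where
      lTQ : LegalFrom A [] (T ++ Q)
      lTQ = legal-++⁺ [] T l lQ

  private? : ∀ P v x → Dec (Private P v x)
  private? P v x = CN? v x ×-dec undominated? P x

  privateNeighbour : List (Fin N) → Fin N → Fin N
  privateNeighbour P v with private? P v v
  ... | yes _ = v
  ... | no _ with any? (private? P v)
  ...   | yes (x , _) = x
  ...   | no _ = v

  privateNeighbour-private : ∀ {P v x} → Private P v x → Private P v (privateNeighbour P v)
  privateNeighbour-private {P} {v} {x} p with private? P v v
  ... | yes q = q
  ... | no _ with any? (private? P v)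
  ...   | yes (_ , q) = q
  ...   | no none = contradiction (x , p) none

  privateNeighbour-self : ∀ {P v} → Undominated P v → privateNeighbour P v ≡ v
  privateNeighbour-self {P} {v} u with private? P v v
  ... | yes _ = refl
  ... | no ¬p = contradiction (inj₁ refl , u) ¬p

module Lexicographic {m n : ℕ} (G : Adj m) (H : Adj n) where

  V : Set
  V = Fin (m * n)

  L : Adj (m * n)
  L = lex G H

  π₁ : V → Fin m
  π₁ i = proj₁ (remQuot {m} n i)

  π₂ : V → Fin n
  π₂ i = proj₂ (remQuot {m} n i)

  π₁-combine : ∀ (g : Fin m) (h : Fin n) → π₁ (combine g h) ≡ g
  π₁-combine g h = cong proj₁ (remQuot-combine {m} {n} g h)

  π₂-combine : ∀ (g : Fin m) (h : Fin n) → π₂ (combine g h) ≡ h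
  π₂-combine g h = cong proj₂ (remQuot-combine {m} {n} g h)

  π-injective : ∀ {i j} → π₁ i ≡ π₁ j → π₂ i ≡ π₂ j → i ≡ j
  π-injective {i} {j} e₁ e₂ =
    trans (sym (combine-remQuot {m} n i)) (trans (cong₂ combine e₁ e₂) (combine-remQuot {m} n j))

  lex-unfold : ∀ i j → L i j ≡ G (π₁ i) (π₁ j) ∨ (does (π₁ i ≟ π₁ j) ∧ H (π₂ i) (π₂ j))
  lex-unfold i j with remQuot {m} n i | remQuot {m} n j
  ... | _ | _ = refl

  lex-CN⁻ : ∀ {i j} → CN L i j → (π₁ i ≡ π₁ j × CN H (π₂ i) (π₂ j)) ⊎ G (π₁ i) (π₁ j) ≡ true
  lex-CN⁻ (inj₁ refl) = inj₁ (refl , inj₁ refl)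
  lex-CN⁻ {i} {j} (inj₂ Lij) rewrite lex-unfold i j with G (π₁ i) (π₁ j) | π₁ i ≟ π₁ j
  ... | true  | _     = inj₂ refl
  ... | false | yes e = inj₁ (e , inj₂ Lij)

  lex-CN⁺-G : ∀ {i j} → G (π₁ i) (π₁ j) ≡ true → CN L i j
  lex-CN⁺-G {i} {j} g = inj₂ (trans (lex-unfold i j) (cong (_∨ (does (π₁ i ≟ π₁ j) ∧ H (π₂ i) (π₂ j))) g))

  lex-CN⁺-H : ∀ {i j} → π₁ i ≡ π₁ j → CN H (π₂ i) (π₂ j) → CN L i j
  lex-CN⁺-H e (inj₁ e₂) = inj₁ (π-injective e e₂)
  lex-CN⁺-H {i} {j} e (inj₂ h) with π₁ i ≟ π₁ j | lex-unfold i j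
  ... | yes _ | Lij rewrite h = inj₂ (trans Lij (∨-zeroʳ _))
  ... | no ne | _ = contradiction e ne

  lex-CN⇒CN : ∀ {i j} → CN L i j → CN G (π₁ i) (π₁ j)
  lex-CN⇒CN c with lex-CN⁻ c
  ... | inj₁ (e , _) = inj₁ e
  ... | inj₂ g       = inj₂ g

  lex-CN⇒CN-fibre : ∀ {u g y} → CN L u (combine g y) → CN G (π₁ u) g
  lex-CN⇒CN-fibre {u} {g} {y} c = subst (CN G (π₁ u)) (π₁-combine g y) (lex-CN⇒CN c)

  lex-CN-fibre : (∀ v → G v v ≡ false) → ∀ {i j} → π₁ i ≡ π₁ j → CN L i j → CN H (π₂ i) (π₂ j)
  lex-CN-fibre irrefl {i} e c with lex-CN⁻ c
  ... | inj₁ (_ , h) = h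
  ... | inj₂ g = contradiction (trans (sym g) (subst (λ X → G (π₁ i) X ≡ false) e (irrefl (π₁ i)))) λ ()

module SplitGraph {m : ℕ} (G : Adj m) (simple : IsSimple G) (I : Subset m)
                  (maxIndependent : IsMaxIndependent G I) (clique : ComplementClique G I) where

  G-sym : ∀ u v → G u v ≡ G v u
  G-sym = proj₁ simple

  G-irrefl : ∀ v → G v v ≡ false
  G-irrefl = proj₂ simple

  adjacent⇒≢ : ∀ {u v} → G u v ≡ true → u ≢ v
  adjacent⇒≢ {u} uv refl = contradiction (trans (sym uv) (G-irrefl u)) λ ()

  I-independent : ∀ {u v} → u ∈ I → v ∈ I → G u v ≡ false
  I-independent = proj₁ maxIndependent _ _

  I-¬CN : ∀ {u v} → u ∈ I → v ∈ I → u ≢ v → ¬ CN G u v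
  I-¬CN _   _   u≢v (inj₁ u≡v) = u≢v u≡v
  I-¬CN u∈I v∈I _   (inj₂ uv)  = contradiction (trans (sym uv) (I-independent u∈I v∈I)) λ ()

  K-clique : ∀ {u v} → u ∉ I → v ∉ I → u ≢ v → G u v ≡ true
  K-clique = clique _ _

  ∈⇒∉⇒≢ : ∀ {u v} → u ∈ I → v ∉ I → u ≢ v
  ∈⇒∉⇒≢ u∈I v∉I refl = v∉I u∈I

  K-has-I-neighbour : ∀ {c} → c ∉ I → ∃ λ g → g ∈ I × G c g ≡ true
  K-has-I-neighbour {c} c∉I with any? (λ g → (g ∈? I) ×-dec (G c g Bool.≟ true))
  ... | yes (g , g∈I , cg) = g , g∈I , cg
  ... | no none = contradiction (proj₂ maxIndependent J J-independent) (<⇒≱ ∣I∣<∣J∣)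
    where
      J : Subset m
      J = I ∪ ⁅ c ⁆

      ∣I∣<∣J∣ : ∣ I ∣ < ∣ J ∣
      ∣I∣<∣J∣ = p⊂q⇒∣p∣<∣q∣ (p⊆p∪q ⁅ c ⁆ , c , x∈p∪q⁺ (inj₂ (x∈⁅x⁆ c)) , c∉I)

      c-I : ∀ {v} → v ∈ I → G c v ≡ false
      c-I v∈I = ¬-not (λ cv → none (_ , v∈I , cv))

      J-independent : Independent G J
      J-independent u v u∈J v∈J with x∈p∪q⁻ I ⁅ c ⁆ u∈J | x∈p∪q⁻ I ⁅ c ⁆ v∈J
      ... | inj₁ u∈I | inj₁ v∈I = I-independent u∈I v∈I
      ... | inj₁ u∈I | inj₂ v∈c rewrite x∈⁅y⁆⇒x≡y c v∈c = trans (G-sym u c) (c-I u∈I)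
      ... | inj₂ u∈c | inj₁ v∈I rewrite x∈⁅y⁆⇒x≡y c u∈c = c-I v∈I
      ... | inj₂ u∈c | inj₂ v∈c rewrite x∈⁅y⁆⇒x≡y c u∈c | x∈⁅y⁆⇒x≡y c v∈c = G-irrefl c

  CommonINeighbour : Fin m → Fin m → Set
  CommonINeighbour v w = ∃ λ x → x ∈ I × G v x ≡ true × G w x ≡ true

  Separated : Fin m → Fin m → Set
  Separated v w = v ∉ I × w ∉ I × ¬ CommonINeighbour v w

  separated : Fin m → Fin m → Bool
  separated v w = not (lookup I v) ∧ not (lookup I w)
                  ∧ all (λ x → not (lookup I x ∧ G v x ∧ G w x)) (allFin m)

  ∉⇒lookup≡false : ∀ {x} → x ∉ I → lookup I x ≡ false
  ∉⇒lookup≡false {x} x∉I with lookup I x in e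
  ... | true  = contradiction (lookup⇒[]= x I e) x∉I
  ... | false = refl

  lookup≡false⇒∉ : ∀ {x} → lookup I x ≡ false → x ∉ I
  lookup≡false⇒∉ e x∈I = contradiction (trans (sym ([]=⇒lookup x∈I)) e) λ ()

  separated-sound : ∀ v w → T (separated v w) → Separated v w
  separated-sound v w s with lookup I v in ev | lookup I w in ew
  ... | false | false =
    lookup≡false⇒∉ ev , lookup≡false⇒∉ ew , λ (x , x∈I , vx , wx) → noCommon x x∈I vx wx
    where
      noCommon : ∀ x → x ∈ I → G v x ≡ true → G w x ≡ true → ⊥
      noCommon x x∈I vx wx with All.lookup (all⁺ _ (allFin m) s) (∈-allFin x)
      ... | px rewrite []=⇒lookup x∈I | vx | wx = px

  separated-complete : ∀ {v w} → Separated v w → T (separated v w)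
  separated-complete {v} {w} (v∉I , w∉I , ¬common)
    rewrite ∉⇒lookup≡false v∉I | ∉⇒lookup≡false w∉I = all⁻ _ (tabulate⁺ noCommon)
    where
      noCommon : ∀ x → T (not (lookup I x ∧ G v x ∧ G w x))
      noCommon x with lookup I x in ex | G v x in vx | G w x in wx
      ... | true  | true  | true  = ¬common (x , lookup⇒[]= x I ex , vx , wx)
      ... | true  | true  | false = tt
      ... | true  | false | _     = tt
      ... | false | _     | _     = tt

  nG-cases : (nG G I ≡ 1 × ∃₂ Separated)
           ⊎ (nG G I ≡ 0 × ∀ {v w} → v ∉ I → w ∉ I → CommonINeighbour v w)
  nG-cases with any (λ v → any (separated v) (allFin m)) (allFin m) in e
  ... | true with satisfied (any⁻ (λ v → any (separated v) (allFin m)) (allFin m) (subst T (sym e) tt))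
  ...   | v , sv with satisfied (any⁻ (separated v) (allFin m) sv)
  ...     | w , svw = inj₁ (refl , v , w , separated-sound v w svw)
  nG-cases | false = inj₂ (refl , common)
    where
      common : ∀ {v w} → v ∉ I → w ∉ I → CommonINeighbour v w
      common {v} {w} v∉I w∉I
        with any? (λ x → (x ∈? I) ×-dec (G v x Bool.≟ true) ×-dec (G w x Bool.≟ true))
      ... | yes (x , x∈I , vx , wx) = x , x∈I , vx , wx
      ... | no none = contradiction (subst T e (any-allFin⁺ _ v (any-allFin⁺ (separated v) w svw))) λ ()
        where
          svw : T (separated v w)
          svw = separated-complete (v∉I , w∉I , λ (x , x∈I , vx , wx) → none (x , x∈I , vx , wx))

module UpperBound {m n : ℕ} (G : Adj m) (H : Adj n) (simpleG : IsSimple G)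
                  (I : Subset m) (maxIndependent : IsMaxIndependent G I) (clique : ComplementClique G I)
                  {k : ℕ} (grundyH : IsGrundyDomNumber H k) where

  open Lexicographic G H
  open SplitGraph G simpleG I maxIndependent clique
  open Sequences L
  module H = Sequences H

  InI : V → Set
  InI u = π₁ u ∈ I

  hit : V → Fin m → ℕ
  hit x X = if does (π₁ x ≟ X) then 1 else 0

  hit-≢ : ∀ {x X} → π₁ x ≢ X → hit x X ≡ 0
  hit-≢ {x} {X} ne = cong (if_then 1 else 0) (dec-false (π₁ x ≟ X) ne)

  load : Fin m → List V → List V → ℕ
  load X P []      = 0
  load X P (s ∷ S) = hit (privateNeighbour P s) X + load X (P ∷ʳ s) S

  load-++ : ∀ X P S₁ S₂ → load X P (S₁ ++ S₂) ≡ load X P S₁ + load X (P ++ S₁) S₂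
  load-++ X P []       S₂ = cong (λ Q → load X Q S₂) (sym (++-identityʳ P))
  load-++ X P (s ∷ S₁) S₂ = begin
    h + load X P′ (S₁ ++ S₂)                     ≡⟨ cong (h +_) (load-++ X P′ S₁ S₂) ⟩
    h + (load X P′ S₁ + load X (P′ ++ S₁) S₂)    ≡⟨ cong (λ Q → h + (load X P′ S₁ + load X Q S₂)) (++-assoc P [ s ] S₁) ⟩
    h + (load X P′ S₁ + load X (P ++ s ∷ S₁) S₂) ≡⟨ +-assoc h (load X P′ S₁) _ ⟨
    h + load X P′ S₁ + load X (P ++ s ∷ S₁) S₂   ∎
    where
      open ≡-Reasoning
      h : ℕ
      h = hit (privateNeighbour P s) X

      P′ : List V
      P′ = P ∷ʳ s

  ∑-load : ∀ P S → ∑[ X < m ] load X P S ≡ length S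
  ∑-load P []      = sum-replicate-zero m
  ∑-load P (s ∷ S) = trans (∑-distrib-+ (hit x) (λ X → load X (P ∷ʳ s) S))
                            (cong₂ _+_ (∑-δ (π₁ x) 1) (∑-load (P ∷ʳ s) S))
    where
      x : V
      x = privateNeighbour P s

  legal⇒private : ∀ {P s S} → LegalFrom L P (s ∷ S) → Private P s (privateNeighbour P s)
  legal⇒private ((_ , p) , _) = privateNeighbour-private p

  fibre-dominated : ∀ {u X} → G (π₁ u) X ≡ true → ∀ z → π₁ z ≡ X → CN L u z
  fibre-dominated ux z refl = lex-CN⁺-G ux

  load-dominated : ∀ X P S → LegalFrom L P S → (∀ z → π₁ z ≡ X → Dominated P z) → load X P S ≡ 0
  load-dominated X P []      _            _   = refl
  load-dominated X P (s ∷ S) l@(_ , l') dom =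
    cong₂ _+_ (hit-≢ λ e → undominated⇒¬dominated (proj₂ (legal⇒private l)) (dom _ e))
              (load-dominated X (P ∷ʳ s) S l' (λ z e → ++⁺ˡ (dom z e)))

  I-fibres-CN : ∀ {u v} → InI u → InI v → CN L u v → π₁ u ≡ π₁ v
  I-fibres-CN u∈I v∈I c with lex-CN⇒CN c
  ... | inj₁ e = e
  ... | inj₂ g = contradiction (trans (sym g) (I-independent u∈I v∈I)) λ ()

  across-fibres : ∀ {u v} → CN L u v → π₁ u ≢ π₁ v → G (π₁ u) (π₁ v) ≡ true
  across-fibres c ne with lex-CN⇒CN c
  ... | inj₁ e = contradiction e ne
  ... | inj₂ g = g

  FibreInvariant : Fin m → List V → List (Fin n) → Set
  FibreInvariant X P T = ∀ z → π₁ z ≡ X → Undominated P z → H.Undominated T (π₂ z)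

  invariant-∷ʳ : ∀ {X P T} s → FibreInvariant X P T → FibreInvariant X (P ∷ʳ s) T
  invariant-∷ʳ s inv z e u = inv z e (++⁻ˡ _ u)

  invariant-extend : ∀ {X P T s} → π₁ s ≡ X → FibreInvariant X P T → FibreInvariant X (P ∷ʳ s) (T ∷ʳ π₂ s)
  invariant-extend s∈X inv z z∈X u with ∷ʳ⁻ u
  ... | uP , ¬sz = ∷ʳ⁺ (inv z z∈X uP) (λ h → ¬sz (lex-CN⁺-H (trans s∈X (sym z∈X)) h))

  -- The fibre lemma: the elements whose private neighbour lies in the fibre X,
  -- read in H, extend T to a legal sequence of H.
  load+length≤k : ∀ X P S T → LegalFrom L P S → LegalFrom H [] T → FibreInvariant X P T
                → load X P S + length T ≤ k
  load+length≤k X P []      T _            lT _   = H.legal⇒length≤ grundyH T lT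
  load+length≤k X P (s ∷ S) T l@(_ , l') lT inv with legal⇒private l | π₁ (privateNeighbour P s) ≟ X
  ... | _ | no x∉X = load+length≤k X (P ∷ʳ s) S T l' lT (invariant-∷ʳ s inv)
  ... | c , u | yes x∈X with π₁ s ≟ X
  ...   | yes s∈X =                                       -- π₂ s extends T
    subst (_≤ k) (trans (cong (load X (P ∷ʳ s) S +_) (length-∷ʳ T (π₂ s))) (+-suc _ (length T)))
          (load+length≤k X (P ∷ʳ s) S (T ∷ʳ π₂ s) l' lT′ (invariant-extend s∈X inv))
    where
      lT′ : LegalFrom H [] (T ∷ʳ π₂ s)
      lT′ = H.legal-∷ʳ [] T lT (lex-CN-fibre G-irrefl (trans s∈X (sym x∈X)) c , inv _ x∈X u)
  ...   | no s∉X =                                        -- s dominates the fibre X; π₂ x ends T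
    subst (_≤ k) (trans (length-∷ʳ T (π₂ x)) (cong (λ a → suc (a + length T)) (sym load≡0)))
          (H.legal⇒length≤ grundyH (T ∷ʳ π₂ x) lT′)
    where
      x : V
      x = privateNeighbour P s

      sx : G (π₁ s) X ≡ true
      sx = subst (λ Y → G (π₁ s) Y ≡ true) x∈X (across-fibres c (λ e → s∉X (trans e x∈X)))

      load≡0 : load X (P ∷ʳ s) S ≡ 0
      load≡0 = load-dominated X (P ∷ʳ s) S l' (λ z e → ++⁺ʳ P (here (fibre-dominated sx z e)))

      lT′ : LegalFrom H [] (T ∷ʳ π₂ x)
      lT′ = H.legal-∷ʳ [] T lT (inj₁ refl , inv _ x∈X u)

  load≤k : ∀ X S → LegalFrom L [] S → load X [] S ≤ k
  load≤k X S l = subst (_≤ k) (+-identityʳ _) (load+length≤k X [] S [] l _ (λ _ _ _ → []))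

  -- A vertex of an I-fibre that is dominated is dominated from its own fibre, which then
  -- covers every neighbouring fibre: so its private neighbours lie in its own fibre.
  privateNeighbour-own-fibre : ∀ {P s S} → All InI P → InI s → LegalFrom L P (s ∷ S)
                             → π₁ (privateNeighbour P s) ≡ π₁ s
  privateNeighbour-own-fibre {P} {s} P⊆I s∈I l with dominated? P s
  ... | no ¬d = cong π₁ (privateNeighbour-self (¬dominated⇒undominated ¬d))
  ... | yes d with find d | π₁ (privateNeighbour P s) ≟ π₁ s
  ...   | _ | yes e = e
  ...   | u , u∈P , us | no ne =
    contradiction (lex-CN⁺-G ux) (All.lookup (proj₂ (legal⇒private l)) u∈P)
    where
      ux : G (π₁ u) (π₁ (privateNeighbour P s)) ≡ true
      ux = trans (cong (λ Y → G Y _) (I-fibres-CN (All.lookup P⊆I u∈P) s∈I us))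
                 (across-fibres (proj₁ (legal⇒private l)) (ne ∘ sym))

  load-I-prefix : ∀ X P S → All InI P → All InI S → LegalFrom L P S → All (λ u → π₁ u ≢ X) S
                → load X P S ≡ 0
  load-I-prefix X P []      _   _              _            _             = refl
  load-I-prefix X P (s ∷ S) P⊆I (s∈I ∷ S⊆I) l@(_ , l') (s∉X ∷ S∉X) =
    cong₂ _+_ (hit-≢ (s∉X ∘ trans (sym (privateNeighbour-own-fibre P⊆I s∈I l))))
              (load-I-prefix X (P ∷ʳ s) S (∷ʳ⁺ P⊆I s∈I) S⊆I l' S∉X)

  avoids-fibres-off-I : ∀ {S X} → All InI S → X ∉ I → All (λ u → π₁ u ≢ X) S
  avoids-fibres-off-I S⊆I X∉I = All.map (λ u∈I e → X∉I (subst (_∈ I) e u∈I)) S⊆I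

  avoids-fibres-near : ∀ {P y Y} → Undominated P y → G Y (π₁ y) ≡ true → All (λ u → π₁ u ≢ Y) P
  avoids-fibres-near u Yy = All.map (λ ¬uy e → ¬uy (lex-CN⁺-G (subst (λ Z → G Z _ ≡ true) (sym e) Yy))) u

  hit≤1 : ∀ x X → hit x X ≤ 1
  hit≤1 x X with does (π₁ x ≟ X)
  ... | true  = s≤s z≤n
  ... | false = z≤n

  module FirstKVertex (S₁ : List V) (s : V) (S₂ : List V) (S₁⊆I : All InI S₁) (s∉I : π₁ s ∉ I)
                      (l : LegalFrom L [] (S₁ ++ s ∷ S₂)) where

    c : Fin m
    c = π₁ s

    f : V
    f = privateNeighbour S₁ s

    l₁ : LegalFrom L [] S₁
    l₁ = proj₁ (legal-++⁻ [] S₁ l)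

    l₂ : LegalFrom L S₁ (s ∷ S₂)
    l₂ = proj₂ (legal-++⁻ [] S₁ l)

    f-private : Private S₁ s f
    f-private = legal⇒private l₂

    b : Fin m → ℕ
    b X = load X [] (S₁ ++ s ∷ S₂)

    open Budget I k b (λ X → load≤k X _ l)

    b-split : ∀ X → b X ≡ load X [] S₁ + (hit f X + load X (S₁ ∷ʳ s) S₂)
    b-split X = load-++ X [] S₁ (s ∷ S₂)

    S₁-off-I : ∀ {X} → X ∉ I → load X [] S₁ ≡ 0
    S₁-off-I X∉I = load-I-prefix _ [] S₁ [] S₁⊆I l₁ (avoids-fibres-off-I S₁⊆I X∉I)

    after-s : ∀ {X} → G c X ≡ true → load X (S₁ ∷ʳ s) S₂ ≡ 0
    after-s cX = load-dominated _ (S₁ ∷ʳ s) S₂ (proj₂ l₂) λ z e → ++⁺ʳ S₁ (here (fibre-dominated cX z e))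

    b-K-fibre : ∀ {X} → X ∉ I → c ≢ X → b X ≡ hit f X
    b-K-fibre {X} X∉I c≢X =
      trans (b-split X)
            (trans (cong₂ _+_ (S₁-off-I X∉I) (cong (hit f X +_) (after-s (K-clique s∉I X∉I c≢X))))
                   (+-identityʳ (hit f X)))

    -- S₁ avoids the fibre Y, for otherwise it would dominate f, and s dominates it.
    b-common-neighbour : ∀ {Y} → Y ∈ I → G (π₁ f) Y ≡ true → G c Y ≡ true → b Y ≡ 0
    b-common-neighbour {Y} Y∈I fY cY =
      trans (b-split Y) (cong₂ _+_ S₁-avoids (cong₂ _+_ (hit-≢ (adjacent⇒≢ fY)) (after-s cY)))
      where
        S₁-avoids : load Y [] S₁ ≡ 0
        S₁-avoids = load-I-prefix Y [] S₁ [] S₁⊆I l₁ (avoids-fibres-near (proj₂ f-private) (trans (G-sym Y _) fY))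

    f-in-c : π₁ f ≡ c → sum b ≤ ∣ I ∣ * k
    f-in-c f∈c with K-has-I-neighbour s∉I
    ... | g , g∈I , cg = ∑≤budget-swap c g g∈I (b-common-neighbour g∈I fg cg) b-other-K
      where
        fg : G (π₁ f) g ≡ true
        fg = subst (λ Z → G Z g ≡ true) (sym f∈c) cg

        b-other-K : ∀ X → X ∉ I → X ≢ c → b X ≡ 0
        b-other-K X X∉I X≢c = trans (b-K-fibre X∉I (X≢c ∘ sym)) (hit-≢ (λ e → X≢c (trans (sym e) f∈c)))

    module OutsideC (f∉c : π₁ f ≢ c) where

      -- As f ≠ s, the vertex s is dominated by S₁, from an I-fibre next to c.
      c-dominated : ∀ z → π₁ z ≡ c → Dominated S₁ z
      c-dominated with dominated? S₁ s
      ... | no ¬d = contradiction (cong π₁ (privateNeighbour-self (¬dominated⇒undominated ¬d))) f∉c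
      ... | yes d with find d
      ...   | u , u∈S₁ , us = λ z e → lose u∈S₁ (fibre-dominated uc z e)
        where
          uc : G (π₁ u) c ≡ true
          uc = across-fibres us (∈⇒∉⇒≢ (All.lookup S₁⊆I u∈S₁) s∉I)

      bc≡0 : b c ≡ 0
      bc≡0 = trans (b-split c)
                   (cong₂ _+_ (S₁-off-I s∉I)
                              (cong₂ _+_ (hit-≢ f∉c)
                                         (load-dominated c (S₁ ∷ʳ s) S₂ (proj₂ l₂) λ z e → ++⁺ˡ (c-dominated z e))))

      b-off-f : ∀ X → X ∉ I → X ≢ π₁ f → b X ≡ 0
      b-off-f X X∉I X≢f with c ≟ X
      ... | yes refl = bc≡0
      ... | no c≢X   = trans (b-K-fibre X∉I c≢X) (hit-≢ (X≢f ∘ sym))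

      ∑b≤ : sum b ≤ ∣ I ∣ * k + nG G I
      ∑b≤ with π₁ f ∈? I
      ... | yes f∈I =
        ≤-trans (∑≤budget λ X X∉I → b-off-f X X∉I λ e → X∉I (subst (_∈ I) (sym e) f∈I)) (m≤m+n _ _)
      ... | no f∉I with nG-cases
      ...   | inj₁ (nG≡1 , _) rewrite nG≡1 =
        ∑≤budget+1 (π₁ f) (subst (_≤ 1) (sym (b-K-fibre f∉I (f∉c ∘ sym))) (hit≤1 f _)) b-off-f
      ...   | inj₂ (_ , common) with common s∉I f∉I
      ...     | g , g∈I , cg , fg =
        ≤-trans (∑≤budget-swap (π₁ f) g g∈I (b-common-neighbour g∈I fg cg) b-off-f) (m≤m+n _ _)

    ∑b≤ : sum b ≤ ∣ I ∣ * k + nG G I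
    ∑b≤ with π₁ f ≟ c
    ... | yes f∈c = ≤-trans (f-in-c f∈c) (m≤m+n _ _)
    ... | no f∉c  = OutsideC.∑b≤ f∉c

  fibre-in-I? : ∀ u → InI u ⊎ π₁ u ∉ I
  fibre-in-I? u with π₁ u ∈? I
  ... | yes u∈I = inj₁ u∈I
  ... | no u∉I  = inj₂ u∉I

  ∑load≤ : ∀ S → LegalFrom L [] S → ∑[ X < m ] load X [] S ≤ ∣ I ∣ * k + nG G I
  ∑load≤ S l with first fibre-in-I? S
  ... | inj₂ S⊆I = ≤-trans (Budget.∑≤budget I k (λ X → load X [] S) (λ X → load≤k X S l)
                                            (λ X X∉I → load-I-prefix X [] S [] S⊆I l (avoids-fibres-off-I S⊆I X∉I)))
                           (m≤m+n _ _)
  ... | inj₁ S-K with toView S-K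
  ...   | prefix-first-rest S₁⊆I s∉I S₂ = FirstKVertex.∑b≤ _ _ S₂ S₁⊆I s∉I l

  length≤ : ∀ S → LegalFrom L [] S → length S ≤ ∣ I ∣ * k + nG G I
  length≤ S l = subst (_≤ ∣ I ∣ * k + nG G I) (∑-load [] S) (∑load≤ S l)

module LowerBound {m n : ℕ} (G : Adj m) (H : Adj n) (simpleG : IsSimple G)
                  (I : Subset m) (maxIndependent : IsMaxIndependent G I) (clique : ComplementClique G I)
                  (T : List (Fin n)) (T-legal : LegalFrom H [] T) (T-dominates : Dominates H T)
                  {k : ℕ} (T-length : length T ≡ k) {t₀ : Fin n} (t₀∈T : t₀ ∈ₗ T) where

  open Lexicographic G H
  open SplitGraph G simpleG I maxIndependent clique
  open Sequences L
  module H = Sequences H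

  block : Fin m → List V
  block g = map (combine g) T

  block-fibre : ∀ g → All (λ u → π₁ u ≡ g) (block g)
  block-fibre g = Allₚ.map⁺ (All.universal (λ t → π₁-combine g t) T)

  -- Playing T inside the fibre g mirrors T being played in H, as long as the earlier
  -- vertices P only reach fibre g where Q already dominates.
  block-legal : ∀ g P Q T′ → LegalFrom H Q T′ → All (λ u → ∀ y → CN L u (combine g y) → H.Dominated Q y) P
              → LegalFrom L P (map (combine g) T′)
  block-legal g P Q []       _                    _   = tt
  block-legal g P Q (t ∷ T′) ((x , tx , x-undom) , l) inv =
    (combine g x , gt-gx , All.map (λ reach gt → H.undominated⇒¬dominated x-undom (reach x gt)) inv) ,
    block-legal g (P ∷ʳ combine g t) (Q ∷ʳ t) T′ l
      (∷ʳ⁺ (All.map (λ reach y c → ++⁺ˡ (reach y c)) inv) (λ y c → ++⁺ʳ Q (here (in-fibre c))))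
    where
      gt-gx : CN L (combine g t) (combine g x)
      gt-gx = lex-CN⁺-H (trans (π₁-combine g t) (sym (π₁-combine g x)))
                        (subst₂ (CN H) (sym (π₂-combine g t)) (sym (π₂-combine g x)) tx)

      in-fibre : ∀ {y} → CN L (combine g t) (combine g y) → CN H t y
      in-fibre {y} c = subst₂ (CN H) (π₂-combine g t) (π₂-combine g y)
                              (lex-CN-fibre G-irrefl (trans (π₁-combine g t) (sym (π₁-combine g y))) c)

  Far : (Fin m → Set) → List V → List (Fin m) → Set
  Far Sel P gs = All (λ u → All (λ g → Sel g → ¬ CN G (π₁ u) g) gs) P

  module Blocks {Sel : Fin m → Set} (Sel? : Decidable Sel) (Sel⊆I : ∀ {g} → Sel g → g ∈ I) where

    blockIf : Fin m → List V
    blockIf g = if does (Sel? g) then block g else []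

    blocks : List V
    blocks = concatMap blockIf (allFin m)

    blocks-legal : ∀ P gs → Unique gs → Far Sel P gs → LegalFrom L P (concatMap blockIf gs)
    blocks-legal P []       _               _   = tt
    blocks-legal P (g ∷ gs) (g∉gs ∷ gs-uniq) far with Sel? g
    ... | no _     = blocks-legal P gs gs-uniq (All.map All.tail far)
    ... | yes Selg =
      legal-++⁺ P (block g)
        (block-legal g P [] T T-legal (All.map (λ far-u y c → ⊥-elim (All.head far-u Selg (lex-CN⇒CN-fibre c))) far))
        (blocks-legal (P ++ block g) gs gs-uniq (++⁺ (All.map All.tail far) block-far))
      where
        g-far : All (λ g′ → Sel g′ → ¬ CN G g g′) gs
        g-far = All.map (λ g≢g′ Selg′ → I-¬CN (Sel⊆I Selg) (Sel⊆I Selg′) g≢g′) g∉gs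

        block-far : Far Sel (block g) gs
        block-far = All.map (λ e → subst (λ Z → All (λ g′ → Sel g′ → ¬ CN G Z g′) gs) (sym e) g-far)
                            (block-fibre g)

    length-blocks : length blocks ≡ ∑[ X < m ] (if does (Sel? X) then k else 0)
    length-blocks = trans (length-concatMap-tabulate blockIf (λ g → g)) (sum-cong-≗ length-blockIf)
      where
        length-blockIf : ∀ g → length (blockIf g) ≡ (if does (Sel? g) then k else 0)
        length-blockIf g with does (Sel? g)
        ... | true  = trans (length-map (combine g) T) T-length
        ... | false = refl

    block⊆blocks : ∀ {g} → Sel g → ∀ {Q : V → Set} → Any Q (block g) → Any Q blocks
    block⊆blocks {g} Selg {Q} a = Anyₚ.concat⁺ (Anyₚ.map⁺ (Any.map (λ { refl → a′ }) (∈-allFin g)))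
      where
        a′ : Any Q (blockIf g)
        a′ with Sel? g
        ... | yes _    = a
        ... | no ¬Selg = contradiction Selg ¬Selg

    blocks-fibres : All (λ u → Sel (π₁ u)) blocks
    blocks-fibres = concat⁺ (Allₚ.map⁺ (tabulate⁺ blockIf-fibres))
      where
        blockIf-fibres : ∀ g → All (λ u → Sel (π₁ u)) (blockIf g)
        blockIf-fibres g with Sel? g
        ... | yes Selg = All.map (λ e → subst Sel (sym e) Selg) (block-fibre g)
        ... | no _     = []

  dominates-via-blocks : ∀ S → (∀ {g} → g ∈ I → ∀ {Q : V → Set} → Any Q (block g) → Any Q S) → Dominates L S
  dominates-via-blocks S ⊇ x with π₁ x ∈? I
  ... | yes x∈I = ⊇ x∈I (Anyₚ.map⁺ (Any.map same-fibre (T-dominates (π₂ x))))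
    where
      same-fibre : ∀ {t} → CN H t (π₂ x) → CN L (combine (π₁ x) t) x
      same-fibre {t} c =
        lex-CN⁺-H (π₁-combine (π₁ x) t) (subst (λ z → CN H z (π₂ x)) (sym (π₂-combine (π₁ x) t)) c)
  ... | no x∉I with K-has-I-neighbour x∉I
  ...   | g , g∈I , xg = ⊇ g∈I (Anyₚ.map⁺ (Any.map (λ { refl → lex-CN⁺-G gx }) t₀∈T))
    where
      gx : G (π₁ (combine g t₀)) (π₁ x) ≡ true
      gx = trans (cong (λ Z → G Z (π₁ x)) (π₁-combine g t₀)) (trans (G-sym g (π₁ x)) xg)

  module I-blocks = Blocks (_∈? I) (λ g∈I → g∈I)

  lower-bound₀ : ∃ λ S → LegalDom L S × length S ≡ ∣ I ∣ * k
  lower-bound₀ = blocks , (legal⇒unique [] blocks l , dominates-via-blocks blocks block⊆blocks , l) ,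
                 trans length-blocks (∑-indicator I k)
    where
      open I-blocks
      l : LegalFrom L [] blocks
      l = blocks-legal [] (allFin m) (allFin⁺ m) []

  module SeparatedPair {v w : Fin m} (separated : Separated v w) where

    v∉I : v ∉ I
    v∉I = proj₁ separated

    w∉I : w ∉ I
    w∉I = proj₁ (proj₂ separated)

    ¬common : ¬ CommonINeighbour v w
    ¬common = proj₂ (proj₂ separated)

    Sel₁ Sel₂ : Fin m → Set
    Sel₁ g = g ∈ I × G w g ≡ false
    Sel₂ g = g ∈ I × G w g ≡ true

    Sel₁? : Decidable Sel₁
    Sel₁? g = (g ∈? I) ×-dec (G w g Bool.≟ false)

    Sel₂? : Decidable Sel₂
    Sel₂? g = (g ∈? I) ×-dec (G w g Bool.≟ true)

    module B₁ = Blocks Sel₁? proj₁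
    module B₂ = Blocks Sel₂? proj₁

    vt₀ wt₀ : V
    vt₀ = combine v t₀
    wt₀ = combine w t₀

    -- The I-fibres not adjacent to w, then (v , t₀) with private neighbour (w , t₀), then the other I-fibres.
    S : List V
    S = B₁.blocks ++ vt₀ ∷ B₂.blocks

    v≢w : v ≢ w
    v≢w refl with K-has-I-neighbour v∉I
    ... | g , g∈I , vg = ¬common (g , g∈I , vg , vg)

    vt₀-wt₀ : CN L vt₀ wt₀
    vt₀-wt₀ = lex-CN⁺-G (subst₂ (λ a b → G a b ≡ true) (sym (π₁-combine v t₀)) (sym (π₁-combine w t₀))
                                (K-clique v∉I w∉I v≢w))

    B₁-far-from-w : ∀ {g} → Sel₁ g → ¬ CN G g w
    B₁-far-from-w (g∈I , _)  (inj₁ refl) = w∉I g∈I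
    B₁-far-from-w {g} (_ , wg) (inj₂ gw) = contradiction (trans (sym gw) (trans (G-sym g w) wg)) λ ()

    wt₀-undominated : Undominated B₁.blocks wt₀
    wt₀-undominated = All.map (λ Sel₁u c → B₁-far-from-w Sel₁u (lex-CN⇒CN-fibre c)) B₁.blocks-fibres

    B₁-far-from-B₂ : ∀ {g g′} → Sel₁ g → Sel₂ g′ → ¬ CN G g g′
    B₁-far-from-B₂ (g∈I , wg) (g′∈I , wg′) = I-¬CN g∈I g′∈I λ { refl → contradiction (trans (sym wg) wg′) λ () }

    v-far-from-B₂ : ∀ {g} → Sel₂ g → ¬ CN G (π₁ vt₀) g
    v-far-from-B₂ {g} (g∈I , wg) c with subst (λ a → CN G a g) (π₁-combine v t₀) c
    ... | inj₁ refl = v∉I g∈I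
    ... | inj₂ vg   = ¬common (g , g∈I , vg , wg)

    S-legal : LegalFrom L [] S
    S-legal = legal-++⁺ [] B₁.blocks (B₁.blocks-legal [] (allFin m) (allFin⁺ m) [])
                ((wt₀ , vt₀-wt₀ , wt₀-undominated) , B₂.blocks-legal (B₁.blocks ∷ʳ vt₀) (allFin m) (allFin⁺ m) far)
      where
        far : Far Sel₂ (B₁.blocks ∷ʳ vt₀) (allFin m)
        far = ∷ʳ⁺ (All.map (λ Sel₁u → tabulate⁺ λ _ → B₁-far-from-B₂ Sel₁u) B₁.blocks-fibres)
                  (tabulate⁺ λ _ → v-far-from-B₂)

    block⊆S : ∀ {g} → g ∈ I → ∀ {Q : V → Set} → Any Q (block g) → Any Q S
    block⊆S {g} g∈I a with G w g in wg
    ... | false = ++⁺ˡ (B₁.block⊆blocks (g∈I , wg) a)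
    ... | true  = ++⁺ʳ B₁.blocks (there (B₂.block⊆blocks (g∈I , wg) a))

    w₁ w₂ : Fin m → ℕ
    w₁ X = if does (Sel₁? X) then k else 0
    w₂ X = if does (Sel₂? X) then k else 0

    w₁+w₂ : ∀ X → w₁ X + w₂ X ≡ (if does (X ∈? I) then k else 0)
    w₁+w₂ X with X ∈? I | G w X
    ... | yes _ | true  = refl
    ... | yes _ | false = +-identityʳ k
    ... | no _  | _     = refl

    length-S : length S ≡ ∣ I ∣ * k + 1
    length-S = begin
      length S                                  ≡⟨ length-++ B₁.blocks ⟩
      length B₁.blocks + suc (length B₂.blocks) ≡⟨ cong₂ (λ a b → a + suc b) B₁.length-blocks B₂.length-blocks ⟩
      sum w₁ + suc (sum w₂)                     ≡⟨ +-suc (sum w₁) (sum w₂) ⟩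
      suc (sum w₁ + sum w₂)                     ≡⟨ cong suc (∑-distrib-+ w₁ w₂) ⟨
      suc (∑[ X < m ] (w₁ X + w₂ X))            ≡⟨ cong suc (trans (sum-cong-≗ w₁+w₂) (∑-indicator I k)) ⟩
      suc (∣ I ∣ * k)                           ≡⟨ +-comm 1 (∣ I ∣ * k) ⟩
      ∣ I ∣ * k + 1                             ∎
      where open ≡-Reasoning

  lower-bound₁ : ∀ {v w} → Separated v w → ∃ λ S → LegalDom L S × length S ≡ ∣ I ∣ * k + 1
  lower-bound₁ separated =
    S , (legal⇒unique [] S S-legal , dominates-via-blocks S block⊆S , S-legal) , length-S
    where open SeparatedPair separated

corollary3 : ∀ (m n : ℕ) (G : Adj m) (H : Adj n) → IsSimple G → IsSimple H → 1 ≤ n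
    → (I : Subset m) → IsMaxIndependent G I → ComplementClique G I
    → ∀ (k : ℕ) → IsGrundyDomNumber H k
    → IsGrundyDomNumber (lex G H) (∣ I ∣ * k + nG G I)
corollary3 m n G H simpleG _ 1≤n I maxIndependent clique k
           grundyH@((T , (_ , T-dominates , T-legal) , T-length) , _) = lower , upper
  where
    open UpperBound G H simpleG I maxIndependent clique grundyH using (length≤)
    open LowerBound G H simpleG I maxIndependent clique T T-legal T-dominates T-length
                    (proj₁ (proj₂ (find (T-dominates (fromℕ< 1≤n)))))
    open SplitGraph G simpleG I maxIndependent clique using (nG-cases)

    lower : ∃ λ S → LegalDom (lex G H) S × length S ≡ ∣ I ∣ * k + nG G I
    lower with nG-cases
    ... | inj₁ (nG≡1 , _ , _ , separated) rewrite nG≡1 = lower-bound₁ separated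
    ... | inj₂ (nG≡0 , _) rewrite nG≡0 | +-identityʳ (∣ I ∣ * k) = lower-bound₀

    upper : ∀ S → LegalDom (lex G H) S → length S ≤ ∣ I ∣ * k + nG G I
    upper S (_ , _ , l) = length≤ S l
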